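{- Let $\widetilde B_n$ be a set of representatives for the isomorphism classes of matroids on the ground set $[n]=\{1,\dots,n\}$, let $\omega_n=1\wedge2\wedge\cdots\wedge n$, and let $B_n=\{(\mathsf M,\omega_n):\mathsf M\in\widetilde B_n,\ \mathrm{Aut}(\mathsf M)\subseteq A_n\}$. Then $\{[\mathsf M,\omega_n]:(\mathsf M,\omega_n)\in B_n\}$ is a basis of $\mathcal M_n$, and for $(\mathsf M,\omega_n)\in B_n$, $$\partial_{\mathrm{del}}([\mathsf M,\omega_n])=\sum_{\substack{i\in[n]\\ i\text{ not a coloop}}}\ \sum_{(\mathsf M',\omega_{n-1})\in B_{n-1}}(-1)^{i-1}\mu(\mathsf M\setminus i,\mathsf M')\,[\mathsf M',\omega_{n-1}].$$
   Context: An orientation of a matroid $\mathsf M$ is a generator $\eta$ of $\bigwedge^{|E|}\mathbb{Z}\langle E\rangle$, $E=E(\mathsf M)$. $\mathcal M$ is the $\mathbb{Q}$-vector space spanned by symbols $[\mathsf M,\eta]$ modulo $[\mathsf M,-\eta]=-[\mathsf M,\eta]$ and $[\mathsf M,\eta]=[\mathsf M',\psi_*\eta]$ for every matroid isomorphism $\psi:\mathsf M\to\mathsf M'$ ($\psi_*$ the induced map on top exterior powers); $\mathcal M_n$ is the span of classes with $|E(\mathsf M)|=n$. With $\iota_x$ interior product ($\iota_x(x\wedge\alpha)=\alpha$), $\partial_{\mathrm{del}}[\mathsf M,\eta]=\sum_{x\text{ not a coloop}}[\mathsf M\setminus x,\iota_x\eta]$. $\mathrm{Aut}(\mathsf M)\subseteq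 A_n$ means every automorphism of $\mathsf M$ is an even permutation of $[n]$. For $i\in[n]$, $\rho_i:[n]\setminus\{i\}\to[n-1]$ is the unique order-preserving bijection. For a matroid $\mathsf M$ on $[n]$ and $\mathsf M'$ on $[n-1]$ with $\mathrm{Aut}(\mathsf M')\subseteq A_{n-1}$, $\mu(\mathsf M\setminus i,\mathsf M')=0$ if $\mathsf M\setminus i\not\cong\mathsf M'$, and otherwise $\mu(\mathsf M\setminus i,\mathsf M')=\mathrm{sgn}(\psi\circ\rho_i^{ -1})$ for any isomorphism $\psi:\mathsf M\setminus i\to\mathsf M'$ (well defined since $\mathrm{Aut}(\mathsf M')\subseteq A_{n-1}$). -}

module Defs where

open import Data.Bool.Base using (Bool; true; false; _∧_; _∨_; if_then_else_)
open import Data.Nat.Base as ℕ using (ℕ; zero; suc)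
import Data.Nat.Properties as ℕP
open import Data.Fin.Base as Fin using (Fin; zero; suc; toℕ; punchIn; punchOut)
import Data.Fin.Properties as FinP
open import Data.Fin.Subset using (Subset; ⊥; _∪_; ⁅_⁆; _∈_; _∉_; _⊆_; ∣_∣; inside; outside)
import Data.Fin.Subset.Properties as SubP
open import Data.Vec.Base using (Vec; []; _∷_; insertAt; lookup; tabulate)
import Data.Vec.Properties as VecP
open import Data.List.Base as List using (List; []; _∷_; _++_; allFin; concatMap)
open import Data.Nat.ListAction using () renaming (sum to sumℕ)
open import Data.Product.Base using (Σ; ∃-syntax; _×_; _,_; proj₁; proj₂)
open import Data.Sum.Base using (_⊎_)
open import Data.Sign.Base using (Sign; opposite) renaming (_*_ to _*ₛ_)
open import Data.Rational.Base using (ℚ; 0ℚ; 1ℚ; -_) renaming (_+_ to _+ℚ_; _*_ to _*ℚ_)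
open import Function.Bundles using (_↔_; Inverse)
open import Relation.Nullary using (¬_; Dec; yes; no; does; contradiction)
open import Relation.Binary.PropositionalEquality
  using (_≡_; refl; sym; trans; cong; subst; _≢_)

record MatroidStr (k : ℕ) : Set where
  constructor mkMatroidStr
  field
    indep     : Subset k → Bool
    indep-⊥   : indep ⊥ ≡ true
    indep-⊆   : ∀ {X Y : Subset k} → X ⊆ Y → indep Y ≡ true → indep X ≡ true
    indep-aug : ∀ {X Y : Subset k} → indep X ≡ true → indep Y ≡ true →
                ∣ X ∣ ℕ.< ∣ Y ∣ →
                ∃[ e ] (e ∈ Y × e ∉ X × indep (X ∪ ⁅ e ⁆) ≡ true)

-- A matroid with finite ground set E ⊆ ℕ, |E| = k.  The ground set is
-- E = {lab 0 < lab 1 < … < lab (k-1)}: position i ∈ Fin k is the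
-- (i+1)-st smallest element of E.
record Matroid : Set where
  constructor mkMatroid
  field
    k        : ℕ
    lab      : Fin k → ℕ
    lab-mono : ∀ (i j : Fin k) → i Fin.< j → lab i ℕ.< lab j
    str      : MatroidStr k
  open MatroidStr str public

open Matroid public using (k; lab; str)

indepM : (M : Matroid) → Subset (Matroid.k M) → Bool
indepM M = MatroidStr.indep (Matroid.str M)

onN : ∀ {n} → MatroidStr n → Matroid
onN {n} N = mkMatroid n (λ i → suc (toℕ i)) (λ i j i<j → ℕ.s≤s i<j) N

signPow : ℕ → Sign
signPow zero    = Sign.+
signPow (suc m) = opposite (signPow m)

inversions : ∀ {a b} → (Fin a → Fin b) → ℕ
inversions {a} f =
  sumℕ (List.map (λ i → sumℕ (List.map (λ j →
    if does (i FinP.<? j) ∧ does (f j FinP.<? f i) then 1 else 0) (allFin a))) (allFin a))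

-- sign of a map between ordered finite sets (for a bijection: the sign of
-- the permutation it induces relative to the increasing orders)
sgnMap : ∀ {a b} → (Fin a → Fin b) → Sign
sgnMap f = signPow (inversions f)

signℚ : Sign → ℚ
signℚ Sign.+ = 1ℚ
signℚ Sign.- = - 1ℚ

preimage : ∀ {a b} → (Fin a → Fin b) → Subset b → Subset a
preimage f Y = tabulate (λ i → lookup Y (f i))

record Iso (M M' : Matroid) : Set where
  constructor mkIso
  field
    perm : Fin (Matroid.k M) ↔ Fin (Matroid.k M')
    pres : ∀ (Y : Subset (Matroid.k M')) →
           indepM M (preimage (Inverse.to perm) Y) ≡ indepM M' Y

-- ψ_* on top exterior powers, in terms of the standard generators
-- (increasing wedge of the ground set): multiplication by sgnIso ψ.
sgnIso : ∀ {M M'} → Iso M M' → Sign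
sgnIso ψ = sgnMap (Inverse.to (Iso.perm ψ))

AutEven : Matroid → Set
AutEven M = ∀ (ψ : Iso M M) → sgnIso ψ ≡ Sign.+

IsBasis : (M : Matroid) → Subset (Matroid.k M) → Set
IsBasis M B = indepM M B ≡ true ×
              (∀ e → e ∉ B → indepM M (B ∪ ⁅ e ⁆) ≡ false)

IsColoop : (M : Matroid) → Fin (Matroid.k M) → Set
IsColoop M x = ∀ B → IsBasis M B → x ∈ B

ins : ∀ {n} → Subset n → Fin (suc n) → Subset (suc n)
ins X x = insertAt X x outside

ins-⊥ : ∀ {n} (x : Fin (suc n)) → ins (⊥ {n}) x ≡ ⊥
ins-⊥ zero = refl
ins-⊥ {suc n} (suc x) = cong (outside ∷_) (ins-⊥ x)

ins-∣∣ : ∀ {n} (X : Subset n) (x : Fin (suc n)) → ∣ ins X x ∣ ≡ ∣ X ∣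
ins-∣∣ X zero = refl
ins-∣∣ (true ∷ X) (suc x) = cong suc (ins-∣∣ X x)
ins-∣∣ (false ∷ X) (suc x) = ins-∣∣ X x

ins-∪ : ∀ {n} (X : Subset n) (x : Fin (suc n)) (e : Fin n) →
        ins (X ∪ ⁅ e ⁆) x ≡ ins X x ∪ ⁅ punchIn x e ⁆
ins-∪ X zero e = refl
ins-∪ {suc n} (a ∷ X) (suc x) zero =
  cong ((a ∨ true) ∷_)
    (trans (cong (λ Z → ins Z x) (SubP.∪-identityʳ X))
           (sym (SubP.∪-identityʳ (ins X x))))
ins-∪ (a ∷ X) (suc x) (suc e) = cong ((a ∨ false) ∷_) (ins-∪ X x e)

ins-mem : ∀ {n} {X : Subset n} (x : Fin (suc n)) {j} → j ∈ X → punchIn x j ∈ ins X x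
ins-mem {X = X} x {j} j∈X =
  VecP.lookup⇒[]= _ _ (trans (VecP.insertAt-punchIn X x outside j) (VecP.[]=⇒lookup j∈X))

ins-mem⁻ : ∀ {n} {X : Subset n} (x : Fin (suc n)) {j} → punchIn x j ∈ ins X x → j ∈ X
ins-mem⁻ {X = X} x {j} p =
  VecP.lookup⇒[]= _ _ (trans (sym (VecP.insertAt-punchIn X x outside j)) (VecP.[]=⇒lookup p))

mem-ins : ∀ {n} {X : Subset n} (x : Fin (suc n)) {i} → i ∈ ins X x →
          ∃[ j ] (i ≡ punchIn x j × j ∈ X)
mem-ins {X = X} x {i} p with x FinP.≟ i
... | yes refl = contradiction (trans (sym (VecP.[]=⇒lookup p)) (VecP.insertAt-lookup X x outside)) (λ ())
... | no x≢i = punchOut x≢i , sym (FinP.punchIn-punchOut x≢i) ,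
               ins-mem⁻ x (subst (_∈ ins X x) (sym (FinP.punchIn-punchOut x≢i)) p)

ins-⊆ : ∀ {n} {X Y : Subset n} (x : Fin (suc n)) → X ⊆ Y → ins X x ⊆ ins Y x
ins-⊆ x X⊆Y p with mem-ins x p
... | j , refl , j∈X = ins-mem x (X⊆Y j∈X)

deleteStr : ∀ {n} → MatroidStr (suc n) → Fin (suc n) → MatroidStr n
deleteStr {n} N x = mkMatroidStr ind ind-⊥ ind-⊆ ind-aug
  where
  open MatroidStr N
  ind : Subset n → Bool
  ind Y = indep (ins Y x)
  ind-⊥ : ind ⊥ ≡ true
  ind-⊥ = subst (λ Z → indep Z ≡ true) (sym (ins-⊥ x)) indep-⊥
  ind-⊆ : ∀ {X Y : Subset n} → X ⊆ Y → ind Y ≡ true → ind X ≡ true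
  ind-⊆ X⊆Y = indep-⊆ (ins-⊆ x X⊆Y)
  ind-aug : ∀ {X Y : Subset n} → ind X ≡ true → ind Y ≡ true → ∣ X ∣ ℕ.< ∣ Y ∣ →
            ∃[ e ] (e ∈ Y × e ∉ X × ind (X ∪ ⁅ e ⁆) ≡ true)
  ind-aug {X} {Y} iX iY lt
    with indep-aug iX iY (subst₂' (ins-∣∣ X x) (ins-∣∣ Y x) lt)
    where
    subst₂' : ∀ {a b c d} → a ≡ c → b ≡ d → c ℕ.< d → a ℕ.< b
    subst₂' refl refl p = p
  ... | e' , e'∈ , e'∉ , ok with mem-ins x e'∈
  ... | j , refl , j∈Y =
    j , j∈Y , (λ j∈X → e'∉ (ins-mem x j∈X)) ,
    subst (λ Z → indep Z ≡ true) (sym (ins-∪ X x j)) ok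

punchIn-mono-< : ∀ {n} (x : Fin (suc n)) (i j : Fin n) → i Fin.< j → punchIn x i Fin.< punchIn x j
punchIn-mono-< x i j i<j =
  FinP.≤∧≢⇒< (FinP.punchIn-mono-≤ x i j (ℕP.<⇒≤ i<j))
    (λ eq → ℕP.<⇒≢ i<j (cong toℕ (FinP.punchIn-injective x i j eq)))

delete : (M : Matroid) → Fin (Matroid.k M) → Matroid
delete (mkMatroid zero lab mono N) ()
delete (mkMatroid (suc n) lab mono N) x =
  mkMatroid n (λ i → lab (punchIn x i))
    (λ i j i<j → mono (punchIn x i) (punchIn x j) (punchIn-mono-< x i j i<j))
    (deleteStr N x)

-- The space 𝓜.
-- An oriented matroid symbol [M, η]: η = s · (e₁ ∧ ⋯ ∧ e_k) where
-- e₁ < ⋯ < e_k is the ground set in increasing order and s = ±1.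

Sym : Set
Sym = Matroid × Sign

Comb : Set
Comb = List (ℚ × Sym)

-- Equality in 𝓜: the least congruence presenting the free ℚ-vector space
-- on the symbols (commutativity, collecting like terms, dropping zero
-- terms) modulo  [M,-η] = -[M,η]  and  [M,η] = [M',ψ_*η].
infix 4 _≈ᴹ_
data _≈ᴹ_ : Comb → Comb → Set where
  ≈-refl  : ∀ {a} → a ≈ᴹ a
  ≈-sym   : ∀ {a b} → a ≈ᴹ b → b ≈ᴹ a
  ≈-trans : ∀ {a b c} → a ≈ᴹ b → b ≈ᴹ c → a ≈ᴹ c
  ≈-++    : ∀ {a b c d} → a ≈ᴹ b → c ≈ᴹ d → a ++ c ≈ᴹ b ++ d
  ≈-comm  : ∀ a b → a ++ b ≈ᴹ b ++ a
  ≈-merge : ∀ q r (x : Sym) → (q , x) ∷ (r , x) ∷ [] ≈ᴹ (q +ℚ r , x) ∷ []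
  ≈-zero  : ∀ (x : Sym) → (0ℚ , x) ∷ [] ≈ᴹ []
  ≈-neg   : ∀ q M s → (q , (M , opposite s)) ∷ [] ≈ᴹ (- q , (M , s)) ∷ []
  ≈-iso   : ∀ q {M M'} (ψ : Iso M M') s →
            (q , (M , s)) ∷ [] ≈ᴹ (q , (M' , s *ₛ sgnIso ψ)) ∷ []

-- ∂_del [M, η] = Σ_{x not a coloop} [M \ x, ι_x η], where the coloop
-- test is supplied as a decision procedure.  With η = s·(e₁∧⋯∧e_k) and
-- x = e_{p+1}, ι_x η = s·(-1)^p·(e₁∧⋯ê_{p+1}⋯∧e_k).
∂del : (M : Matroid) (s : Sign) → (∀ x → Dec (IsColoop M x)) → Comb
∂del M s dec = concatMap term (allFin (Matroid.k M))
  where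
  term : Fin (Matroid.k M) → Comb
  term x with dec x
  ... | yes _ = []
  ... | no  _ = (1ℚ , (delete M x , s *ₛ signPow (toℕ x))) ∷ []

IsReps : (n m : ℕ) → (Fin m → MatroidStr n) → Set
IsReps n m R = (∀ (N : MatroidStr n) → ∃[ j ] Iso (onN N) (onN (R j))) ×
               (∀ j j' → Iso (onN (R j)) (onN (R j')) → j ≡ j')

basisComb : ∀ {n m} → (Fin m → MatroidStr n) → (Fin m → ℚ) → Comb
basisComb {m = m} R c = List.map (λ j → (c j , (onN (R j) , Sign.+))) (allFin m)

-- μ(M \ i, M'): 0 if not isomorphic, else sgn(ψ ∘ ρ_i⁻¹) for an iso ψ
-- (in positions, ψ ∘ ρ_i⁻¹ is just ψ).
IsMu : Matroid → Matroid → ℚ → Set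
IsMu A B z = (¬ Iso A B × z ≡ 0ℚ) ⊎ (Σ (Iso A B) λ ψ → z ≡ signℚ (sgnIso ψ))

-- Right-hand side of the deletion formula for M = onN N on [n+1]:
-- Σ_{x not a coloop} Σ_{j' ∈ B_n} (-1)^{(x+1)-1} μ(M∖x, R'_j') [R'_j', ω_n]
delRHS : ∀ {n m'} (N : MatroidStr (suc n)) (R' : Fin m' → MatroidStr n) →
         (∀ j' → Dec (AutEven (onN (R' j')))) →
         (∀ x → Dec (IsColoop (onN N) x)) →
         (Fin (suc n) → Fin m' → ℚ) → Comb
delRHS {n} {m'} N R' evenDec dec μ = concatMap outer (allFin (suc n))
  where
  inner : Fin (suc n) → Fin m' → Comb
  inner x j' with evenDec j'
  ... | no  _ = []
  ... | yes _ = (signℚ (signPow (toℕ x)) *ℚ μ x j' , (onN (R' j') , Sign.+)) ∷ []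
  outer : Fin (suc n) → Comb
  outer x with dec x
  ... | yes _ = []
  ... | no  _ = concatMap (inner x) (allFin m')

{-# OPTIONS --safe #-}
module Submission where

-- An isomorphism onto its representative R j turns a symbol [M, ±ω] into a
-- signed multiple of [R j, ω], and [R j, ω] = -[R j, ω] = 0 when R j has an odd
-- automorphism; so the even representatives span.  For independence, the coefficient of
-- an even representative X (the sum of the coefficients of the symbols isomorphic to X,
-- each multiplied by the sign of such an isomorphism) respects every relation of 𝓜,
-- because all isomorphisms onto X have the same sign; this rests on the multiplicativity of signs of bijections, proved by
-- counting inversions.  Expanding each summand [M ∖ i, ι_i ω] of ∂_del in this basis gives
-- the deletion formula, μ being exactly the coefficient.

open import Defs
open import Data.Bool.Base using (Bool; true; false; _∧_; not; if_then_else_)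
import Data.Bool.Properties as BoolP
open import Data.Fin.Base using (Fin; zero; suc; toℕ)
import Data.Fin.Permutation as Perm
import Data.Fin.Properties as FinP
open import Data.Fin.Subset using (Subset)
open import Data.Fin.Subset.Properties using (anySubset?)
open import Data.List.Base as List using ([]; _∷_; _++_; [_]; allFin; concatMap)
import Data.List.Properties as ListP
open import Data.List.Relation.Unary.All using (All; []; _∷_)
open import Data.Nat.Base using (ℕ; zero; suc; _+_)
open import Data.Nat.ListAction using () renaming (sum to sumℕ)
import Data.Nat.Properties as ℕP
open import Data.Product.Base using (Σ; ∃; ∃₂; ∃-syntax; _×_; _,_; proj₁; proj₂)
open import Data.Rational.Base using (ℚ; 0ℚ; 1ℚ; ½; -_) renaming (_+_ to _+ℚ_; _*_ to _*ℚ_)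
import Data.Rational.Properties as ℚP
open import Data.Sign.Base using (Sign; opposite) renaming (_*_ to _*ₛ_)
import Data.Sign.Properties as SignP
open import Data.Sum.Base using (inj₁; inj₂)
open import Data.Unit.Base using (⊤; tt)
open import Data.Vec.Base using (Vec; []; _∷_; lookup; tabulate)
open import Data.Vec.Functional using (updateAt)
open import Data.Vec.Functional.Properties using (updateAt-updates; updateAt-minimal)
import Data.Vec.Properties as VecP
open import Function.Base using (id; _∘_)
open import Function.Bundles using (_↔_; Inverse; Injection; mk↔ₛ′)
open import Function.Construct.Composition using (_↔-∘_)
open import Function.Construct.Identity using (↔-id)
open import Function.Construct.Symmetry using (↔-sym)
open import Function.Properties.Inverse using (↔⇒↣)
open import Level using (0ℓ)
open import Relation.Binary.Bundles using (Setoid)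
open import Relation.Binary.Definitions using (tri<; tri≈; tri>)
open import Relation.Binary.PropositionalEquality hiding ([_])
import Relation.Binary.Reasoning.Setoid
open import Relation.Nullary using (¬_; Dec; yes; no; contradiction)
import Relation.Nullary.Decidable as Dec
open import Relation.Nullary.Decidable using (does; dec-true; dec-false)
open import Relation.Unary using (Decidable)
open import Algebra.Properties.CommutativeMonoid.Sum ℕP.+-0-commutativeMonoid
  using (sum; sum-cong-≗; ∑-distrib-+; ∑-comm; sum-permute)
open import Algebra.Properties.Group ℚP.+-0-group using () renaming (⁻¹-involutive to neg-involutive)

-- Signs of bijections

opposite-*ˡ : ∀ s t → opposite (s *ₛ t) ≡ opposite s *ₛ t
opposite-*ˡ Sign.+ t = refl
opposite-*ˡ Sign.- t = SignP.opposite-involutive t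

signPow-+ : ∀ m n → signPow (m + n) ≡ signPow m *ₛ signPow n
signPow-+ zero    n = refl
signPow-+ (suc m) n = trans (cong opposite (signPow-+ m n)) (opposite-*ˡ (signPow m) (signPow n))

signPow-+-double : ∀ m u → signPow (m + (u + u)) ≡ signPow m
signPow-+-double m u = begin
  signPow (m + (u + u))                     ≡⟨ signPow-+ m (u + u) ⟩
  signPow m *ₛ signPow (u + u)              ≡⟨ cong (signPow m *ₛ_) (signPow-+ u u) ⟩
  signPow m *ₛ (signPow u *ₛ signPow u)     ≡⟨ cong (signPow m *ₛ_) (SignP.s*s≡+ (signPow u)) ⟩
  signPow m *ₛ Sign.+                       ≡⟨ SignP.*-identityʳ (signPow m) ⟩
  signPow m                                 ∎
  where open ≡-Reasoning

s*t≡+⇒s≡t : ∀ s t → s *ₛ t ≡ Sign.+ → s ≡ t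
s*t≡+⇒s≡t s t st≡+ = SignP.*-cancelʳ-≡ t s t (trans st≡+ (sym (SignP.s*s≡+ t)))

infix 7 _<ᵇ_
_<ᵇ_ : ∀ {n} → Fin n → Fin n → Bool
i <ᵇ j = does (i FinP.<? j)

<ᵇ-irrefl : ∀ {n} (i : Fin n) → (i <ᵇ i) ≡ false
<ᵇ-irrefl i = dec-false (i FinP.<? i) (FinP.<-irrefl refl)

<ᵇ-flip : ∀ {n} {i j : Fin n} → i ≢ j → (j <ᵇ i) ≡ not (i <ᵇ j)
<ᵇ-flip {i = i} {j} i≢j with FinP.<-cmp i j
... | tri< i<j _ j≮i rewrite dec-true (i FinP.<? j) i<j | dec-false (j FinP.<? i) j≮i = refl
... | tri≈ _ i≡j _ = contradiction i≡j i≢j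
... | tri> i≮j _ j<i rewrite dec-false (i FinP.<? j) i≮j | dec-true (j FinP.<? i) j<i = refl

χ : Bool → ℕ
χ b = if b then 1 else 0

inversion : ∀ {a b} → (Fin a → Fin b) → Fin a → Fin a → ℕ
inversion f i j = χ (i <ᵇ j ∧ f j <ᵇ f i)

sum₂ : ∀ {n} → (Fin n → Fin n → ℕ) → ℕ
sum₂ h = sum (λ i → sum (h i))

sumℕ-allFin : ∀ {n} (h : Fin n → ℕ) → sumℕ (List.map h (allFin n)) ≡ sum h
sumℕ-allFin {n} h = trans (cong sumℕ (ListP.map-tabulate id h)) (sumℕ-tabulate n h)
  where
  sumℕ-tabulate : ∀ n (h : Fin n → ℕ) → sumℕ (List.tabulate h) ≡ sum h
  sumℕ-tabulate zero    h = refl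
  sumℕ-tabulate (suc n) h = cong (h zero +_) (sumℕ-tabulate n (h ∘ suc))

inversions-sum₂ : ∀ {a b} (f : Fin a → Fin b) → inversions f ≡ sum₂ (inversion f)
inversions-sum₂ {a} f =
  trans (cong sumℕ (ListP.map-cong (λ i → sumℕ-allFin (inversion f i)) (allFin a)))
        (sumℕ-allFin (λ i → sum (inversion f i)))

sum₂-cong : ∀ {n} {h h′ : Fin n → Fin n → ℕ} → (∀ i j → h i j ≡ h′ i j) → sum₂ h ≡ sum₂ h′
sum₂-cong h≡h′ = sum-cong-≗ (λ i → sum-cong-≗ (h≡h′ i))

sum₂-+ : ∀ {n} (h h′ : Fin n → Fin n → ℕ) → sum₂ (λ i j → h i j + h′ i j) ≡ sum₂ h + sum₂ h′
sum₂-+ h h′ = trans (sum-cong-≗ (λ i → ∑-distrib-+ (h i) (h′ i)))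
                    (∑-distrib-+ (λ i → sum (h i)) (λ i → sum (h′ i)))

sum₂-transpose : ∀ {n} (h : Fin n → Fin n → ℕ) → sum₂ (λ i j → h j i) ≡ sum₂ h
sum₂-transpose h = sym (∑-comm h)

sum₂-permute : ∀ {n} (π : Fin n ↔ Fin n) (h : Fin n → Fin n → ℕ) →
               sum₂ (λ i j → h (Inverse.to π i) (Inverse.to π j)) ≡ sum₂ h
sum₂-permute π h = trans (sum-cong-≗ (λ i → sym (sum-permute (h (Inverse.to π i)) π)))
                         (sym (sum-permute (λ i → sum (h i)) π))

sgnMap-cong : ∀ {a b} {f g : Fin a → Fin b} → (∀ i → f i ≡ g i) → sgnMap f ≡ sgnMap g
sgnMap-cong {f = f} {g} f≗g = cong signPow (begin
  inversions f          ≡⟨ inversions-sum₂ f ⟩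
  sum₂ (inversion f)    ≡⟨ sum₂-cong (λ i j → cong₂ (λ x y → χ (i <ᵇ j ∧ x <ᵇ y)) (f≗g j) (f≗g i)) ⟩
  sum₂ (inversion g)    ≡⟨ inversions-sum₂ g ⟨
  inversions g          ∎)
  where open ≡-Reasoning

χ-cocycle : ∀ a b c → χ (a ∧ not b) + χ (b ∧ not c) ≡
                      χ (a ∧ not c) + (χ (not a ∧ b ∧ not c) + χ (a ∧ not b ∧ c))
χ-cocycle false false false = refl
χ-cocycle false false true  = refl
χ-cocycle false true  false = refl
χ-cocycle false true  true  = refl
χ-cocycle true  false false = refl
χ-cocycle true  false true  = refl
χ-cocycle true  true  false = refl
χ-cocycle true  true  true  = refl

module _ {n} (π ρ : Fin n ↔ Fin n) where
  private
    f g : Fin n → Fin n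
    f = Inverse.to π
    g = Inverse.to ρ

  -- Pairs j < i inverted by f and inverted back by g: inversions of f and of g, not of g ∘ f.
  restored : Fin n → Fin n → ℕ
  restored i j = χ (j <ᵇ i ∧ f i <ᵇ f j ∧ g (f j) <ᵇ g (f i))

  inversion-∘ : ∀ i j → inversion f i j + inversion g (f i) (f j) ≡
                        inversion (g ∘ f) i j + (restored i j + restored j i)
  inversion-∘ i j with i FinP.≟ j
  ... | yes refl rewrite <ᵇ-irrefl i | <ᵇ-irrefl (f i) = refl
  ... | no i≢j
    rewrite <ᵇ-flip i≢j
          | <ᵇ-flip {i = f i} (i≢j ∘ Injection.injective (↔⇒↣ π))
          | <ᵇ-flip {i = g (f i)} (i≢j ∘ Injection.injective (↔⇒↣ π) ∘ Injection.injective (↔⇒↣ ρ))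
    = χ-cocycle (i <ᵇ j) (f i <ᵇ f j) (g (f i) <ᵇ g (f j))

  sgnMap-∘-square : sgnMap (g ∘ f) ≡ sgnMap g *ₛ sgnMap f
  sgnMap-∘-square = begin
    signPow (inversions (g ∘ f))
      ≡⟨ cong signPow (inversions-sum₂ (g ∘ f)) ⟩
    signPow (sum₂ (inversion (g ∘ f)))
      ≡⟨ signPow-+-double (sum₂ (inversion (g ∘ f))) (sum₂ restored) ⟨
    signPow (sum₂ (inversion (g ∘ f)) + (sum₂ restored + sum₂ restored))
      ≡⟨ cong signPow inversion-sums ⟨
    signPow (sum₂ (inversion f) + sum₂ (inversion g))
      ≡⟨ signPow-+ (sum₂ (inversion f)) (sum₂ (inversion g)) ⟩
    signPow (sum₂ (inversion f)) *ₛ signPow (sum₂ (inversion g))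
      ≡⟨ cong₂ (λ x y → signPow x *ₛ signPow y) (inversions-sum₂ f) (inversions-sum₂ g) ⟨
    sgnMap f *ₛ sgnMap g
      ≡⟨ SignP.*-comm (sgnMap f) (sgnMap g) ⟩
    sgnMap g *ₛ sgnMap f ∎
    where
    open ≡-Reasoning
    inversion-sums : sum₂ (inversion f) + sum₂ (inversion g) ≡
                     sum₂ (inversion (g ∘ f)) + (sum₂ restored + sum₂ restored)
    inversion-sums = begin
      sum₂ (inversion f) + sum₂ (inversion g)
        ≡⟨ cong (sum₂ (inversion f) +_) (sum₂-permute π (inversion g)) ⟨
      sum₂ (inversion f) + sum₂ (λ i j → inversion g (f i) (f j))
        ≡⟨ sum₂-+ (inversion f) (λ i j → inversion g (f i) (f j)) ⟨
      sum₂ (λ i j → inversion f i j + inversion g (f i) (f j))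
        ≡⟨ sum₂-cong inversion-∘ ⟩
      sum₂ (λ i j → inversion (g ∘ f) i j + (restored i j + restored j i))
        ≡⟨ sum₂-+ (inversion (g ∘ f)) _ ⟩
      sum₂ (inversion (g ∘ f)) + sum₂ (λ i j → restored i j + restored j i)
        ≡⟨ cong (sum₂ (inversion (g ∘ f)) +_) (sum₂-+ restored _) ⟩
      sum₂ (inversion (g ∘ f)) + (sum₂ restored + sum₂ (λ i j → restored j i))
        ≡⟨ cong (λ r → sum₂ (inversion (g ∘ f)) + (sum₂ restored + r)) (sum₂-transpose restored) ⟩
      sum₂ (inversion (g ∘ f)) + (sum₂ restored + sum₂ restored) ∎

sgnMap-∘ : ∀ {a b c} (π : Fin a ↔ Fin b) (ρ : Fin b ↔ Fin c) →
           sgnMap (Inverse.to ρ ∘ Inverse.to π) ≡ sgnMap (Inverse.to ρ) *ₛ sgnMap (Inverse.to π)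
sgnMap-∘ π ρ with Perm.↔⇒≡ π | Perm.↔⇒≡ ρ
... | refl | refl = sgnMap-∘-square π ρ

-- sgn id is a sign equal to its own square.
sgnMap-id : ∀ {n} → sgnMap (id {A = Fin n}) ≡ Sign.+
sgnMap-id {n} = trans (sgnMap-∘ (↔-id (Fin n)) (↔-id (Fin n))) (SignP.s*s≡+ (sgnMap (id {A = Fin n})))

-- Isomorphisms

isoMap : ∀ {M M′} → Iso M M′ → Fin (Matroid.k M) → Fin (Matroid.k M′)
isoMap ψ = Inverse.to (Iso.perm ψ)

preimage-∘ : ∀ {a b c} (f : Fin a → Fin b) (g : Fin b → Fin c) (Y : Subset c) →
             preimage (g ∘ f) Y ≡ preimage f (preimage g Y)
preimage-∘ f g Y = VecP.tabulate-cong (λ i → sym (VecP.lookup∘tabulate (lookup Y ∘ g) (f i)))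

preimage-cong : ∀ {a b} {f g : Fin a → Fin b} → (∀ i → f i ≡ g i) → (Y : Subset b) →
                preimage f Y ≡ preimage g Y
preimage-cong f≗g Y = VecP.tabulate-cong (cong (lookup Y) ∘ f≗g)

preimage-id : ∀ {a} (Y : Subset a) → preimage id Y ≡ Y
preimage-id = VecP.tabulate∘lookup

Iso-relabel : ∀ (M : Matroid) {lab′ mono′} → Iso M (mkMatroid (Matroid.k M) lab′ mono′ (Matroid.str M))
Iso-relabel M = mkIso (↔-id _) (cong (indepM M) ∘ preimage-id)

Iso-refl : ∀ {M} → Iso M M
Iso-refl {M} = Iso-relabel M

Iso-onN : ∀ (M : Matroid) → Iso M (onN (Matroid.str M))
Iso-onN M = Iso-relabel M

Iso-trans : ∀ {A B C} → Iso A B → Iso B C → Iso A C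
Iso-trans {A} {B} {C} ψ φ = mkIso (Iso.perm φ ↔-∘ Iso.perm ψ) λ Y → begin
  indepM A (preimage (isoMap φ ∘ isoMap ψ) Y)            ≡⟨ cong (indepM A) (preimage-∘ (isoMap ψ) (isoMap φ) Y) ⟩
  indepM A (preimage (isoMap ψ) (preimage (isoMap φ) Y)) ≡⟨ Iso.pres ψ (preimage (isoMap φ) Y) ⟩
  indepM B (preimage (isoMap φ) Y)                       ≡⟨ Iso.pres φ Y ⟩
  indepM C Y                                             ∎
  where open ≡-Reasoning

Iso-sym : ∀ {A B} → Iso A B → Iso B A
Iso-sym {A} {B} ψ = mkIso (↔-sym π) λ Y → sym (begin
  indepM A Y                                                       ≡⟨ cong (indepM A) (preimage-to-from Y) ⟨
  indepM A (preimage (Inverse.to π) (preimage (Inverse.from π) Y)) ≡⟨ Iso.pres ψ (preimage (Inverse.from π) Y) ⟩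
  indepM B (preimage (Inverse.from π) Y)                           ∎)
  where
  open ≡-Reasoning
  π : Fin (Matroid.k A) ↔ Fin (Matroid.k B)
  π = Iso.perm ψ
  preimage-to-from : ∀ Y → preimage (Inverse.to π) (preimage (Inverse.from π) Y) ≡ Y
  preimage-to-from Y = begin
    preimage (Inverse.to π) (preimage (Inverse.from π) Y) ≡⟨ preimage-∘ (Inverse.to π) (Inverse.from π) Y ⟨
    preimage (Inverse.from π ∘ Inverse.to π) Y          ≡⟨ preimage-cong (Inverse.strictlyInverseʳ π) Y ⟩
    preimage id Y                                       ≡⟨ preimage-id Y ⟩
    Y                                                   ∎

sgnIso-trans : ∀ {A B C} (ψ : Iso A B) (φ : Iso B C) → sgnIso (Iso-trans ψ φ) ≡ sgnIso φ *ₛ sgnIso ψ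
sgnIso-trans ψ φ = sgnMap-∘ (Iso.perm ψ) (Iso.perm φ)

sgnIso-sym : ∀ {A B} (ψ : Iso A B) → sgnIso (Iso-sym ψ) ≡ sgnIso ψ
sgnIso-sym {A} {B} ψ = s*t≡+⇒s≡t (sgnIso (Iso-sym ψ)) (sgnIso ψ) (begin
  sgnIso (Iso-sym ψ) *ₛ sgnIso ψ               ≡⟨ sgnMap-∘ (Iso.perm ψ) (↔-sym (Iso.perm ψ)) ⟨
  sgnMap (Inverse.from π ∘ Inverse.to π)       ≡⟨ sgnMap-cong (Inverse.strictlyInverseʳ π) ⟩
  sgnMap (id {A = Fin (Matroid.k A)})          ≡⟨ sgnMap-id {Matroid.k A} ⟩
  Sign.+                                       ∎)
  where
  open ≡-Reasoning
  π : Fin (Matroid.k A) ↔ Fin (Matroid.k B)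
  π = Iso.perm ψ

any-Vec? : ∀ {b} n {P : Vec (Fin b) n → Set} → Decidable P → Dec (∃ P)
any-Vec? zero    P? = Dec.map′ ([] ,_) (λ { ([] , p) → p }) (P? [])
any-Vec? (suc n) P? = Dec.map′ (λ (i , v , p) → i ∷ v , p) (λ { (i ∷ v , p) → i , v , p })
                               (FinP.any? λ i → any-Vec? n (P? ∘ (i ∷_)))

all-Subset? : ∀ {n} {P : Subset n → Set} → Decidable P → Dec (∀ Y → P Y)
all-Subset? P? = Dec.map′ (λ ∄¬P Y → Dec.decidable-stable (P? Y) (∄¬P ∘ (Y ,_)))
                          (λ ∀P (Y , ¬PY) → ¬PY (∀P Y))
                          (Dec.¬? (anySubset? (Dec.¬? ∘ P?)))

-- Isomorphisms are searched for as pairs of mutually inverse vectors; the property P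
-- must respect pointwise equality because an isomorphism is recovered from its vector
-- only up to it.
module _ (A B : Matroid) {P : (Fin (Matroid.k A) → Fin (Matroid.k B)) → Set}
         (P-resp : ∀ {f g} → (∀ i → f i ≡ g i) → P f → P g) (P? : Decidable P) where
  private
    a b : ℕ
    a = Matroid.k A
    b = Matroid.k B

    IsoVec : Vec (Fin b) a → Vec (Fin a) b → Set
    IsoVec v w = (∀ i → lookup w (lookup v i) ≡ i) × (∀ i → lookup v (lookup w i) ≡ i) ×
                 (∀ Y → indepM A (preimage (lookup v) Y) ≡ indepM B Y) × P (lookup v)

    IsoVec? : ∀ v w → Dec (IsoVec v w)
    IsoVec? v w = FinP.all? (λ i → lookup w (lookup v i) FinP.≟ i)
             Dec.×-dec FinP.all? (λ i → lookup v (lookup w i) FinP.≟ i)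
             Dec.×-dec all-Subset? (λ Y → indepM A (preimage (lookup v) Y) BoolP.≟ indepM B Y)
             Dec.×-dec P? (lookup v)

    fromVec : ∃₂ IsoVec → Σ (Iso A B) (P ∘ isoMap)
    fromVec (v , w , wv , vw , pres , Pv) = mkIso (mk↔ₛ′ (lookup v) (lookup w) vw wv) pres , Pv

    toVec : Σ (Iso A B) (P ∘ isoMap) → ∃₂ IsoVec
    toVec (ψ , Pψ) = tabulate f , tabulate g ,
      (λ i → trans (VecP.lookup∘tabulate g _)
                   (trans (cong g (VecP.lookup∘tabulate f i)) (Inverse.strictlyInverseʳ π i))) ,
      (λ i → trans (VecP.lookup∘tabulate f _)
                   (trans (cong f (VecP.lookup∘tabulate g i)) (Inverse.strictlyInverseˡ π i))) ,
      (λ Y → trans (cong (indepM A) (preimage-cong (VecP.lookup∘tabulate f) Y)) (Iso.pres ψ Y)) ,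
      P-resp (sym ∘ VecP.lookup∘tabulate f) Pψ
      where
      π : Fin a ↔ Fin b
      π = Iso.perm ψ
      f : Fin a → Fin b
      f = Inverse.to π
      g : Fin b → Fin a
      g = Inverse.from π

  search-Iso? : Dec (Σ (Iso A B) (P ∘ isoMap))
  search-Iso? = Dec.map′ fromVec toVec (any-Vec? a λ v → any-Vec? b (IsoVec? v))

Iso? : ∀ A B → Dec (Iso A B)
Iso? A B = Dec.map′ proj₁ (_, tt) (search-Iso? A B {P = λ _ → ⊤} (λ _ _ → tt) (λ _ → yes tt))

OddAut : Matroid → Set
OddAut X = Σ (Iso X X) λ ψ → sgnIso ψ ≡ Sign.-

OddAut? : ∀ X → Dec (OddAut X)
OddAut? X = search-Iso? X X (λ f≗g → trans (sym (sgnMap-cong f≗g))) (λ f → sgnMap f SignP.≟ Sign.-)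

¬OddAut⇒AutEven : ∀ {X} → ¬ OddAut X → AutEven X
¬OddAut⇒AutEven ¬odd ψ with sgnIso ψ in sgn≡
... | Sign.+ = refl
... | Sign.- = contradiction (ψ , sgn≡) ¬odd

AutEven? : ∀ X → Dec (AutEven X)
AutEven? X = Dec.map′ ¬OddAut⇒AutEven (λ even (ψ , odd) → contradiction (trans (sym (even ψ)) odd) λ ())
                      (Dec.¬? (OddAut? X))

¬AutEven⇒OddAut : ∀ {X} → ¬ AutEven X → OddAut X
¬AutEven⇒OddAut {X} ¬even = Dec.decidable-stable (OddAut? X) (¬even ∘ ¬OddAut⇒AutEven)

𝓜-setoid : Setoid 0ℓ 0ℓ
𝓜-setoid = record
  { Carrier = Comb
  ; _≈_ = _≈ᴹ_
  ; isEquivalence = record { refl = ≈-refl ; sym = ≈-sym ; trans = ≈-trans }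
  }

module 𝓜-Reasoning = Relation.Binary.Reasoning.Setoid 𝓜-setoid

≈-reflexive : ∀ {a b} → a ≡ b → a ≈ᴹ b
≈-reflexive refl = ≈-refl

≈-interchange : ∀ a b c d → (a ++ b) ++ (c ++ d) ≈ᴹ (a ++ c) ++ (b ++ d)
≈-interchange a b c d = begin
  (a ++ b) ++ (c ++ d)   ≡⟨ ListP.++-assoc a b (c ++ d) ⟩
  a ++ (b ++ (c ++ d))   ≡⟨ cong (a ++_) (ListP.++-assoc b c d) ⟨
  a ++ ((b ++ c) ++ d)   ≈⟨ ≈-++ (≈-refl {a}) (≈-++ (≈-comm b c) (≈-refl {d})) ⟩
  a ++ ((c ++ b) ++ d)   ≡⟨ cong (a ++_) (ListP.++-assoc c b d) ⟩
  a ++ (c ++ (b ++ d))   ≡⟨ ListP.++-assoc a c (b ++ d) ⟨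
  (a ++ c) ++ (b ++ d)   ∎
  where open 𝓜-Reasoning

zero-term : ∀ {q} (x : Sym) → q ≡ 0ℚ → [ (q , x) ] ≈ᴹ []
zero-term x refl = ≈-zero x

concatMap⁺ : ∀ {A : Set} {T T′ : A → Comb} → (∀ x → T x ≈ᴹ T′ x) →
             ∀ xs → concatMap T xs ≈ᴹ concatMap T′ xs
concatMap⁺ T≈T′ []       = ≈-refl
concatMap⁺ T≈T′ (x ∷ xs) = ≈-++ (T≈T′ x) (concatMap⁺ T≈T′ xs)

concatMap-≈[] : ∀ {A : Set} {T : A → Comb} → (∀ x → T x ≈ᴹ []) → ∀ xs → concatMap T xs ≈ᴹ []
concatMap-≈[] T≈[] []       = ≈-refl
concatMap-≈[] T≈[] (x ∷ xs) = ≈-++ (T≈[] x) (concatMap-≈[] T≈[] xs)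

concatMap-++ᴹ : ∀ {A : Set} (T T′ : A → Comb) xs →
                concatMap (λ x → T x ++ T′ x) xs ≈ᴹ concatMap T xs ++ concatMap T′ xs
concatMap-++ᴹ T T′ []       = ≈-refl
concatMap-++ᴹ T T′ (x ∷ xs) = begin
  (T x ++ T′ x) ++ concatMap (λ x → T x ++ T′ x) xs
    ≈⟨ ≈-++ (≈-refl {T x ++ T′ x}) (concatMap-++ᴹ T T′ xs) ⟩
  (T x ++ T′ x) ++ (concatMap T xs ++ concatMap T′ xs)
    ≈⟨ ≈-interchange (T x) (T′ x) (concatMap T xs) (concatMap T′ xs) ⟩
  (T x ++ concatMap T xs) ++ (T′ x ++ concatMap T′ xs) ∎
  where open 𝓜-Reasoning

concatMap-allFin-suc : ∀ {m} (T : Fin (suc m) → Comb) →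
                       concatMap T (allFin (suc m)) ≡ T zero ++ concatMap (T ∘ suc) (allFin m)
concatMap-allFin-suc {m} T = cong (T zero ++_)
  (trans (cong (concatMap T) (sym (ListP.map-tabulate id suc))) (ListP.concatMap-map T suc (allFin m)))

concatMap-allFin-single : ∀ {m} {T : Fin m → Comb} (j : Fin m) → (∀ i → i ≢ j → T i ≈ᴹ []) →
                          concatMap T (allFin m) ≈ᴹ T j
concatMap-allFin-single {suc m} {T} zero others = begin
  concatMap T (allFin (suc m))                   ≡⟨ concatMap-allFin-suc T ⟩
  T zero ++ concatMap (T ∘ suc) (allFin m)       ≈⟨ ≈-++ (≈-refl {T zero}) rest≈[] ⟩
  T zero ++ []                                   ≡⟨ ListP.++-identityʳ (T zero) ⟩
  T zero                                         ∎
  where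
  open 𝓜-Reasoning
  rest≈[] : concatMap (T ∘ suc) (allFin m) ≈ᴹ []
  rest≈[] = concatMap-≈[] (λ i → others (suc i) λ ()) (allFin m)
concatMap-allFin-single {suc m} {T} (suc j) others = begin
  concatMap T (allFin (suc m))                   ≡⟨ concatMap-allFin-suc T ⟩
  T zero ++ concatMap (T ∘ suc) (allFin m)       ≈⟨ ≈-++ (others zero λ ()) rest≈Tj ⟩
  T (suc j)                                      ∎
  where
  open 𝓜-Reasoning
  rest≈Tj : concatMap (T ∘ suc) (allFin m) ≈ᴹ T (suc j)
  rest≈Tj = concatMap-allFin-single j λ i i≢j → others (suc i) (i≢j ∘ FinP.suc-injective)

infixr 8 _◃_
_◃_ : Sign → ℚ → ℚ
Sign.+ ◃ q = q
Sign.- ◃ q = - q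

◃-distrib-+ : ∀ s p q → s ◃ (p +ℚ q) ≡ s ◃ p +ℚ s ◃ q
◃-distrib-+ Sign.+ p q = refl
◃-distrib-+ Sign.- p q = ℚP.neg-distrib-+ p q

◃-0 : ∀ s → s ◃ 0ℚ ≡ 0ℚ
◃-0 Sign.+ = refl
◃-0 Sign.- = refl

opposite-*-◃ : ∀ s t q → (opposite s *ₛ t) ◃ q ≡ (s *ₛ t) ◃ (- q)
opposite-*-◃ Sign.+ Sign.+ q = refl
opposite-*-◃ Sign.+ Sign.- q = sym (neg-involutive q)
opposite-*-◃ Sign.- Sign.+ q = sym (neg-involutive q)
opposite-*-◃ Sign.- Sign.- q = refl

◃-1ℚ : ∀ s t → (s *ₛ t) ◃ 1ℚ ≡ signℚ s *ℚ signℚ t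
◃-1ℚ Sign.+ Sign.+ = refl
◃-1ℚ Sign.+ Sign.- = refl
◃-1ℚ Sign.- Sign.+ = refl
◃-1ℚ Sign.- Sign.- = refl

positive-symbol : ∀ q X t → [ (q , (X , t)) ] ≈ᴹ [ (t ◃ q , (X , Sign.+)) ]
positive-symbol q X Sign.+ = ≈-refl
positive-symbol q X Sign.- = ≈-neg q X Sign.+

transport-symbol : ∀ q {M M′} (ψ : Iso M M′) s →
                   [ (q , (M , s)) ] ≈ᴹ [ ((s *ₛ sgnIso ψ) ◃ q , (M′ , Sign.+)) ]
transport-symbol q {M′ = M′} ψ s = ≈-trans (≈-iso q ψ s) (positive-symbol q M′ (s *ₛ sgnIso ψ))

-- An odd automorphism identifies [X, ω] with -[X, ω].
OddAut⇒symbol≈[] : ∀ {X} → OddAut X → ∀ q → [ (q , (X , Sign.+)) ] ≈ᴹ []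
OddAut⇒symbol≈[] {X} (ψ , ψ-odd) q = begin
  [ (q , x) ]                    ≡⟨ cong (λ r → [ (r , x) ]) (half+half q) ⟨
  [ (h +ℚ h , x) ]                ≈⟨ ≈-merge h h x ⟨
  (h , x) ∷ [ (h , x) ]          ≈⟨ ≈-++ (≈-refl {[ (h , x) ]}) h≈-h ⟩
  (h , x) ∷ [ (- h , x) ]        ≈⟨ ≈-merge h (- h) x ⟩
  [ (h +ℚ - h , x) ]              ≈⟨ zero-term x (ℚP.+-inverseʳ h) ⟩
  []                             ∎
  where
  open 𝓜-Reasoning
  x : Sym
  x = (X , Sign.+)
  h : ℚ
  h = q *ℚ ½
  half+half : ∀ q → q *ℚ ½ +ℚ q *ℚ ½ ≡ q
  half+half q = trans (sym (ℚP.*-distribˡ-+ q ½ ½)) (ℚP.*-identityʳ q)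
  h≈-h : [ (h , x) ] ≈ᴹ [ (- h , x) ]
  h≈-h = ≈-trans (transport-symbol h ψ Sign.+) (≈-reflexive (cong (λ s → [ (s ◃ h , x) ]) ψ-odd))

basisComb-concatMap : ∀ {n m} (R : Fin m → MatroidStr n) (c : Fin m → ℚ) →
                      basisComb R c ≡ concatMap (λ j → [ (c j , (onN (R j) , Sign.+)) ]) (allFin m)
basisComb-concatMap {m = m} R c =
  sym (trans (sym (ListP.concatMap-map [_] term (allFin m))) (ListP.concatMap-pure (List.map term (allFin m))))
  where
  term : Fin m → ℚ × Sym
  term j = (c j , (onN (R j) , Sign.+))

basisComb-0 : ∀ {n m} (R : Fin m → MatroidStr n) → basisComb R (λ _ → 0ℚ) ≈ᴹ []
basisComb-0 {m = m} R = ≈-trans (≈-reflexive (basisComb-concatMap R _)) (concatMap-≈[] (λ j → ≈-zero _) (allFin m))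

basisComb-+ : ∀ {n m} (R : Fin m → MatroidStr n) (c d : Fin m → ℚ) →
              basisComb R (λ j → c j +ℚ d j) ≈ᴹ basisComb R c ++ basisComb R d
basisComb-+ {m = m} R c d = begin
  basisComb R (λ j → c j +ℚ d j)
    ≡⟨ basisComb-concatMap R _ ⟩
  concatMap (λ j → [ (c j +ℚ d j , B j) ]) (allFin m)
    ≈⟨ concatMap⁺ (λ j → ≈-merge (c j) (d j) (B j)) (allFin m) ⟨
  concatMap (λ j → [ (c j , B j) ] ++ [ (d j , B j) ]) (allFin m)
    ≈⟨ concatMap-++ᴹ (λ j → [ (c j , B j) ]) (λ j → [ (d j , B j) ]) (allFin m) ⟩
  concatMap (λ j → [ (c j , B j) ]) (allFin m) ++ concatMap (λ j → [ (d j , B j) ]) (allFin m)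
    ≡⟨ cong₂ _++_ (basisComb-concatMap R c) (basisComb-concatMap R d) ⟨
  basisComb R c ++ basisComb R d ∎
  where
  open 𝓜-Reasoning
  B : Fin m → Sym
  B j = (onN (R j) , Sign.+)

basisComb-single : ∀ {n m} (R : Fin m → MatroidStr n) {c : Fin m → ℚ} (j : Fin m) →
                   (∀ i → i ≢ j → c i ≡ 0ℚ) → basisComb R c ≈ᴹ [ (c j , (onN (R j) , Sign.+)) ]
basisComb-single R {c} j others = ≈-trans (≈-reflexive (basisComb-concatMap R c))
  (concatMap-allFin-single j λ i i≢j → zero-term _ (others i i≢j))

-- The coefficient of an even matroid

module Coefficient (X : Matroid) (X-even : AutEven X) where

  sgnIso-unique : ∀ {M} (ψ φ : Iso M X) → sgnIso ψ ≡ sgnIso φ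
  sgnIso-unique ψ φ = sym (s*t≡+⇒s≡t (sgnIso φ) (sgnIso ψ) (begin
    sgnIso φ *ₛ sgnIso ψ                     ≡⟨ cong (sgnIso φ *ₛ_) (sgnIso-sym ψ) ⟨
    sgnIso φ *ₛ sgnIso (Iso-sym ψ)           ≡⟨ sgnIso-trans (Iso-sym ψ) φ ⟨
    sgnIso (Iso-trans (Iso-sym ψ) φ)         ≡⟨ X-even (Iso-trans (Iso-sym ψ) φ) ⟩
    Sign.+                                   ∎))
    where open ≡-Reasoning

  coeff₁ : ℚ × Sym → ℚ
  coeff₁ (q , (M , s)) with Iso? M X
  ... | yes ψ = (s *ₛ sgnIso ψ) ◃ q
  ... | no _  = 0ℚ

  coeff : Comb → ℚ
  coeff []      = 0ℚ
  coeff (t ∷ v) = coeff₁ t +ℚ coeff v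

  coeff-++ : ∀ u w → coeff (u ++ w) ≡ coeff u +ℚ coeff w
  coeff-++ []      w = sym (ℚP.+-identityˡ (coeff w))
  coeff-++ (t ∷ u) w = trans (cong (coeff₁ t +ℚ_) (coeff-++ u w)) (sym (ℚP.+-assoc (coeff₁ t) (coeff u) (coeff w)))

  coeff-[_] : ∀ t → coeff [ t ] ≡ coeff₁ t
  coeff-[ t ] = ℚP.+-identityʳ (coeff₁ t)

  coeff₁-+ : ∀ q r x → coeff₁ (q , x) +ℚ coeff₁ (r , x) ≡ coeff₁ (q +ℚ r , x)
  coeff₁-+ q r (M , s) with Iso? M X
  ... | yes ψ = sym (◃-distrib-+ (s *ₛ sgnIso ψ) q r)
  ... | no _  = ℚP.+-identityˡ 0ℚ

  coeff₁-0 : ∀ x → coeff₁ (0ℚ , x) ≡ 0ℚ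
  coeff₁-0 (M , s) with Iso? M X
  ... | yes ψ = ◃-0 (s *ₛ sgnIso ψ)
  ... | no _  = refl

  coeff₁-opposite : ∀ q M s → coeff₁ (q , (M , opposite s)) ≡ coeff₁ (- q , (M , s))
  coeff₁-opposite q M s with Iso? M X
  ... | yes ψ = opposite-*-◃ s (sgnIso ψ) q
  ... | no _  = refl

  coeff₁-iso : ∀ q {M M′} (ψ : Iso M M′) s → coeff₁ (q , (M , s)) ≡ coeff₁ (q , (M′ , s *ₛ sgnIso ψ))
  coeff₁-iso q {M} {M′} ψ s with Iso? M X | Iso? M′ X
  ... | yes φ | yes φ′ = cong (_◃ q) (begin
    s *ₛ sgnIso φ                        ≡⟨ cong (s *ₛ_) (sgnIso-unique φ (Iso-trans ψ φ′)) ⟩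
    s *ₛ sgnIso (Iso-trans ψ φ′)         ≡⟨ cong (s *ₛ_) (sgnIso-trans ψ φ′) ⟩
    s *ₛ (sgnIso φ′ *ₛ sgnIso ψ)         ≡⟨ cong (s *ₛ_) (SignP.*-comm (sgnIso φ′) (sgnIso ψ)) ⟩
    s *ₛ (sgnIso ψ *ₛ sgnIso φ′)         ≡⟨ SignP.*-assoc s (sgnIso ψ) (sgnIso φ′) ⟨
    (s *ₛ sgnIso ψ) *ₛ sgnIso φ′         ∎)
    where open ≡-Reasoning
  ... | yes φ | no ≇  = contradiction (Iso-trans (Iso-sym ψ) φ) ≇
  ... | no ≇  | yes φ′ = contradiction (Iso-trans ψ φ′) ≇
  ... | no _  | no _  = refl

  coeff-resp : ∀ {u w} → u ≈ᴹ w → coeff u ≡ coeff w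
  coeff-resp ≈-refl = refl
  coeff-resp (≈-sym u≈w) = sym (coeff-resp u≈w)
  coeff-resp (≈-trans u≈v v≈w) = trans (coeff-resp u≈v) (coeff-resp v≈w)
  coeff-resp (≈-++ {a} {b} {c} {d} a≈b c≈d) =
    trans (coeff-++ a c) (trans (cong₂ _+ℚ_ (coeff-resp a≈b) (coeff-resp c≈d)) (sym (coeff-++ b d)))
  coeff-resp (≈-comm a b) = trans (coeff-++ a b) (trans (ℚP.+-comm (coeff a) (coeff b)) (sym (coeff-++ b a)))
  coeff-resp (≈-merge q r x) =
    trans (cong (coeff₁ (q , x) +ℚ_) coeff-[ r , x ]) (trans (coeff₁-+ q r x) (sym coeff-[ q +ℚ r , x ]))
  coeff-resp (≈-zero x) = trans coeff-[ 0ℚ , x ] (coeff₁-0 x)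
  coeff-resp (≈-neg q M s) =
    trans coeff-[ q , (M , opposite s) ] (trans (coeff₁-opposite q M s) (sym coeff-[ - q , (M , s) ]))
  coeff-resp (≈-iso q {M} {M′} ψ s) =
    trans coeff-[ q , (M , s) ] (trans (coeff₁-iso q ψ s) (sym coeff-[ q , (M′ , s *ₛ sgnIso ψ) ]))

  coeff₁-self : ∀ q → coeff₁ (q , (X , Sign.+)) ≡ q
  coeff₁-self q with Iso? X X
  ... | yes ψ rewrite X-even ψ = refl
  ... | no ≇ = contradiction Iso-refl ≇

  coeff₁-≇ : ∀ q {M} s → ¬ Iso M X → coeff₁ (q , (M , s)) ≡ 0ℚ
  coeff₁-≇ q {M} s ≇ with Iso? M X
  ... | yes ψ = contradiction ψ ≇
  ... | no _  = refl

  coeff-concatMap-0 : ∀ {A : Set} {T : A → Comb} → (∀ x → coeff (T x) ≡ 0ℚ) →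
                      ∀ xs → coeff (concatMap T xs) ≡ 0ℚ
  coeff-concatMap-0 T≡0 []       = refl
  coeff-concatMap-0 {T = T} T≡0 (x ∷ xs) = begin
    coeff (T x ++ concatMap _ xs)        ≡⟨ coeff-++ (T x) _ ⟩
    coeff (T x) +ℚ coeff (concatMap _ xs) ≡⟨ cong₂ _+ℚ_ (T≡0 x) (coeff-concatMap-0 T≡0 xs) ⟩
    0ℚ +ℚ 0ℚ                              ≡⟨ ℚP.+-identityˡ 0ℚ ⟩
    0ℚ                                   ∎
    where open ≡-Reasoning

  coeff-concatMap-allFin-single : ∀ {m} {T : Fin m → Comb} (j : Fin m) → (∀ i → i ≢ j → coeff (T i) ≡ 0ℚ) →
                                  coeff (concatMap T (allFin m)) ≡ coeff (T j)
  coeff-concatMap-allFin-single {suc m} {T} j others = begin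
    coeff (concatMap T (allFin (suc m)))                      ≡⟨ cong coeff (concatMap-allFin-suc T) ⟩
    coeff (T zero ++ concatMap (T ∘ suc) (allFin m))          ≡⟨ coeff-++ (T zero) _ ⟩
    coeff (T zero) +ℚ coeff (concatMap (T ∘ suc) (allFin m))   ≡⟨ split j others ⟩
    coeff (T j)                                               ∎
    where
    open ≡-Reasoning
    split : ∀ j → (∀ i → i ≢ j → coeff (T i) ≡ 0ℚ) →
            coeff (T zero) +ℚ coeff (concatMap (T ∘ suc) (allFin m)) ≡ coeff (T j)
    split zero others =
      trans (cong (coeff (T zero) +ℚ_) (coeff-concatMap-0 (λ i → others (suc i) λ ()) (allFin m)))
            (ℚP.+-identityʳ (coeff (T zero)))
    split (suc j) others =
      trans (cong₂ _+ℚ_ (others zero λ ())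
                       (coeff-concatMap-allFin-single j λ i i≢j → others (suc i) (i≢j ∘ FinP.suc-injective)))
            (ℚP.+-identityˡ (coeff (T (suc j))))

-- The basis B_n and the expansion of a symbol in it

module Representatives {n m} (R : Fin m → MatroidStr n) (reps : IsReps n m R) where

  representative : ∀ M → Matroid.k M ≡ n → ∃[ j ] Iso M (onN (R j))
  representative M refl with proj₁ reps (Matroid.str M)
  ... | j , ψ = j , Iso-trans (Iso-onN M) ψ

  representative-unique : ∀ {M i j} → Iso M (onN (R i)) → Iso M (onN (R j)) → i ≡ j
  representative-unique ψ φ = proj₂ reps _ _ (Iso-trans (Iso-sym ψ) φ)

  EvenSupported : (Fin m → ℚ) → Set
  EvenSupported c = ∀ j → ¬ AutEven (onN (R j)) → c j ≡ 0ℚ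

  symbol-spanned : ∀ q M s → Matroid.k M ≡ n →
                   ∃[ c ] (EvenSupported c × [ (q , (M , s)) ] ≈ᴹ basisComb R c)
  symbol-spanned q M s M-size with representative M M-size
  ... | j , φ with AutEven? (onN (R j))
  ... | yes even = c , supported , (begin
    [ (q , (M , s)) ]
      ≈⟨ transport-symbol q φ s ⟩
    [ (q′ , (onN (R j) , Sign.+)) ]
      ≡⟨ cong (λ r → [ (r , (onN (R j) , Sign.+)) ]) (updateAt-updates j (λ _ → 0ℚ)) ⟨
    [ (c j , (onN (R j) , Sign.+)) ]
      ≈⟨ basisComb-single R j (λ i i≢j → updateAt-minimal i j (λ _ → 0ℚ) i≢j) ⟨
    basisComb R c ∎)
    where
    open 𝓜-Reasoning
    q′ : ℚ
    q′ = (s *ₛ sgnIso φ) ◃ q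
    c : Fin m → ℚ
    c = updateAt (λ _ → 0ℚ) j (λ _ → q′)
    supported : EvenSupported c
    supported i odd = updateAt-minimal i j (λ _ → 0ℚ) λ { refl → odd even }
  ... | no odd = (λ _ → 0ℚ) , (λ _ _ → refl) , (begin
    [ (q , (M , s)) ]                                   ≈⟨ transport-symbol q φ s ⟩
    [ ((s *ₛ sgnIso φ) ◃ q , (onN (R j) , Sign.+)) ]    ≈⟨ OddAut⇒symbol≈[] (¬AutEven⇒OddAut odd) _ ⟩
    []                                                  ≈⟨ basisComb-0 R ⟨
    basisComb R (λ _ → 0ℚ)                              ∎)
    where open 𝓜-Reasoning

  spanned : ∀ v → All (λ t → Matroid.k (proj₁ (proj₂ t)) ≡ n) v →
            ∃[ c ] (EvenSupported c × v ≈ᴹ basisComb R c)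
  spanned [] [] = (λ _ → 0ℚ) , (λ _ _ → refl) , ≈-sym (basisComb-0 R)
  spanned ((q , (M , s)) ∷ v) (M-size ∷ sizes) with symbol-spanned q M s M-size | spanned v sizes
  ... | c , c-supported , t≈c | d , d-supported , v≈d =
    (λ j → c j +ℚ d j) ,
    (λ j odd → trans (cong₂ _+ℚ_ (c-supported j odd) (d-supported j odd)) (ℚP.+-identityˡ 0ℚ)) ,
    ≈-trans (≈-++ t≈c v≈d) (≈-sym (basisComb-+ R c d))

  independent : ∀ c → EvenSupported c → basisComb R c ≈ᴹ [] → ∀ j → c j ≡ 0ℚ
  independent c c-supported c≈0 j with AutEven? (onN (R j))
  ... | no odd = c-supported j odd
  ... | yes even = begin
    c j                                                          ≡⟨ coeff₁-self (c j) ⟨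
    coeff₁ (c j , (onN (R j) , Sign.+))                          ≡⟨ coeff-[ c j , (onN (R j) , Sign.+) ] ⟨
    coeff [ (c j , (onN (R j) , Sign.+)) ]                       ≡⟨ coeff-concatMap-allFin-single j others ⟨
    coeff (concatMap (λ i → [ (c i , (onN (R i) , Sign.+)) ]) (allFin m))
                                                                 ≡⟨ cong coeff (basisComb-concatMap R c) ⟨
    coeff (basisComb R c)                                        ≡⟨ coeff-resp c≈0 ⟩
    0ℚ                                                           ∎
    where
    open ≡-Reasoning
    open Coefficient (onN (R j)) even
    others : ∀ i → i ≢ j → coeff [ (c i , (onN (R i) , Sign.+)) ] ≡ 0ℚ
    others i i≢j = trans coeff-[ c i , (onN (R i) , Sign.+) ]
                         (coeff₁-≇ (c i) Sign.+ (i≢j ∘ representative-unique Iso-refl))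

  module _ (even? : ∀ j → Dec (AutEven (onN (R j)))) (t : Sign) {D : Matroid} {μ : Fin m → ℚ}
           (isMu : ∀ j → AutEven (onN (R j)) → IsMu D (onN (R j)) (μ j)) where

    μ-term : (j : Fin m) → Dec (AutEven (onN (R j))) → Comb
    μ-term j (yes _) = [ (signℚ t *ℚ μ j , (onN (R j) , Sign.+)) ]
    μ-term j (no _)  = []

    μ-term-even : ∀ j d → AutEven (onN (R j)) → μ-term j d ≡ [ (signℚ t *ℚ μ j , (onN (R j) , Sign.+)) ]
    μ-term-even j (yes _) _    = refl
    μ-term-even j (no odd) even = contradiction even odd

    μ-term-≈[] : ∀ j d → (AutEven (onN (R j)) → ¬ Iso D (onN (R j))) → μ-term j d ≈ᴹ []
    μ-term-≈[] j (no _) _ = ≈-refl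
    μ-term-≈[] j (yes even) ≇ with isMu j even
    ... | inj₁ (_ , μj≡0) = zero-term _ (trans (cong (signℚ t *ℚ_) μj≡0) (ℚP.*-zeroʳ (signℚ t)))
    ... | inj₂ (ψ , _)    = contradiction ψ (≇ even)

    μ-expansion : Matroid.k D ≡ n → [ (1ℚ , (D , t)) ] ≈ᴹ concatMap (λ j → μ-term j (even? j)) (allFin m)
    μ-expansion D-size with representative D D-size
    ... | j₀ , φ with AutEven? (onN (R j₀))
    ... | yes even₀ with isMu j₀ even₀
    ...   | inj₁ (≇ , _) = contradiction φ ≇
    ...   | inj₂ (ψ , μj₀≡sgnψ) = begin
      [ (1ℚ , (D , t)) ]
        ≈⟨ transport-symbol 1ℚ ψ t ⟩
      [ ((t *ₛ sgnIso ψ) ◃ 1ℚ , (onN (R j₀) , Sign.+)) ]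
        ≡⟨ cong (λ q → [ (q , (onN (R j₀) , Sign.+)) ]) sign≡ ⟩
      [ (signℚ t *ℚ μ j₀ , (onN (R j₀) , Sign.+)) ]
        ≡⟨ μ-term-even j₀ (even? j₀) even₀ ⟨
      μ-term j₀ (even? j₀)
        ≈⟨ concatMap-allFin-single j₀ others ⟨
      concatMap (λ j → μ-term j (even? j)) (allFin m) ∎
      where
      open 𝓜-Reasoning
      sign≡ : (t *ₛ sgnIso ψ) ◃ 1ℚ ≡ signℚ t *ℚ μ j₀
      sign≡ = trans (◃-1ℚ t (sgnIso ψ)) (cong (signℚ t *ℚ_) (sym μj₀≡sgnψ))
      others : ∀ j → j ≢ j₀ → μ-term j (even? j) ≈ᴹ []
      others j j≢j₀ = μ-term-≈[] j (even? j) λ _ ψ′ → j≢j₀ (representative-unique ψ′ φ)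
    μ-expansion D-size | j₀ , φ | no odd₀ = begin
      [ (1ℚ , (D , t)) ]                                   ≈⟨ transport-symbol 1ℚ φ t ⟩
      [ ((t *ₛ sgnIso φ) ◃ 1ℚ , (onN (R j₀) , Sign.+)) ]   ≈⟨ OddAut⇒symbol≈[] (¬AutEven⇒OddAut odd₀) _ ⟩
      []                                                   ≈⟨ concatMap-≈[] vanish (allFin m) ⟨
      concatMap (λ j → μ-term j (even? j)) (allFin m)      ∎
      where
      open 𝓜-Reasoning
      vanish : ∀ j → μ-term j (even? j) ≈ᴹ []
      vanish j = μ-term-≈[] j (even? j) λ even ψ →
        odd₀ (subst (AutEven ∘ onN ∘ R) (representative-unique ψ φ) even)

-- The deletion formula

-- The summands of ∂del and delRHS are where-bound, hence out of scope; summandOf recovers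
-- them by unification, so that they can be unfolded by `with`.
summandOf : ∀ {k} (v : Comb) {T : Fin k → Comb} → v ≡ concatMap T (allFin k) → Fin k → Comb
summandOf _ {T} _ = T

module Deletion {n m′} (R′ : Fin m′ → MatroidStr n) (reps′ : IsReps n m′ R′)
                (even? : ∀ j → Dec (AutEven (onN (R′ j)))) (N : MatroidStr (suc n))
                (coloop? : ∀ x → Dec (IsColoop (onN N) x)) (μ : Fin (suc n) → Fin m′ → ℚ)
                (isMu : ∀ x j → AutEven (onN (R′ j)) → IsMu (delete (onN N) x) (onN (R′ j)) (μ x j)) where
  open Representatives R′ reps′

  ∂del-summand delRHS-summand : Fin (suc n) → Comb
  ∂del-summand = summandOf (∂del (onN N) Sign.+ coloop?) refl
  delRHS-summand = summandOf (delRHS N R′ even? coloop? μ) refl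

  -- The `with` also refines the type of o≡, which then names the inner summands of delRHS.
  summand≈ : ∀ x {o} → o ≡ delRHS-summand x → ∂del-summand x ≈ᴹ o
  summand≈ x {o} o≡ with coloop? x
  ... | yes _ = ≈-reflexive (sym o≡)
  ... | no _  = begin
    [ (1ℚ , (delete (onN N) x , t)) ]
      ≈⟨ μ-expansion even? t (isMu x) refl ⟩
    concatMap (λ j → μ-term even? t (isMu x) j (even? j)) (allFin m′)
      ≡⟨ ListP.concatMap-cong inner≡ (allFin m′) ⟨
    concatMap (summandOf o o≡) (allFin m′)
      ≡⟨ o≡ ⟨
    o ∎
    where
    open 𝓜-Reasoning
    t : Sign
    t = signPow (toℕ x)
    inner≡ : ∀ j → summandOf o o≡ j ≡ μ-term even? t (isMu x) j (even? j)
    inner≡ j with even? j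
    ... | yes _ = refl
    ... | no _  = refl

  deletion-formula : ∂del (onN N) Sign.+ coloop? ≈ᴹ delRHS N R′ even? coloop? μ
  deletion-formula = concatMap⁺ (λ x → summand≈ x refl) (allFin (suc n))

proposition6p6 :
    (∀ (n m : ℕ) (R : Fin m → MatroidStr n) → IsReps n m R →
      (∀ (v : Comb) → All (λ t → Matroid.k (proj₁ (proj₂ t)) ≡ n) v →
        ∃[ c ] ((∀ j → ¬ AutEven (onN (R j)) → c j ≡ 0ℚ) × (v ≈ᴹ basisComb R c)))
      ×
      (∀ (c : Fin m → ℚ) → (∀ j → ¬ AutEven (onN (R j)) → c j ≡ 0ℚ) →
        basisComb R c ≈ᴹ [] → ∀ j → c j ≡ 0ℚ))
    ×
    (∀ (n m m' : ℕ) (R : Fin m → MatroidStr (suc n)) (R' : Fin m' → MatroidStr n) →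
      IsReps (suc n) m R → IsReps n m' R' →
      (evenDec : ∀ j' → Dec (AutEven (onN (R' j')))) →
      (j : Fin m) → AutEven (onN (R j)) →
      (dec : ∀ x → Dec (IsColoop (onN (R j)) x)) →
      (μ : Fin (suc n) → Fin m' → ℚ) →
      (∀ x j' → AutEven (onN (R' j')) →
        IsMu (delete (onN (R j)) x) (onN (R' j')) (μ x j')) →
      ∂del (onN (R j)) Sign.+ dec ≈ᴹ delRHS (R j) R' evenDec dec μ)
proposition6p6 =
  (λ n m R reps → let open Representatives R reps in spanned , independent) ,
  (λ n m m′ R R′ reps reps′ even? j _ → Deletion.deletion-formula R′ reps′ even? (R j))
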